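{- Let $P$ be a finite poset. Then the order congruence lattice $\mathcal{O}(P)$ is a meet subsemilattice of the partition lattice $\Pi_P$.
   Context: $\Pi_P$ is the lattice of set partitions of the underlying set of $P$ ordered by refinement. A map $\varphi:P\to Q$ of posets is order-preserving if $x\le y$ implies $\varphi(x)\le\varphi(y)$; its level set partition is the partition of $P$ into the nonempty fibers $\varphi^{ -1}(q)$. $\mathcal{O}(P)$ is the subposet of $\Pi_P$ consisting of all level set partitions of order-preserving maps from $P$ (equivalently, order-preserving maps $P\to\mathbb{Z}$). -}

module Defs where

open import Level using (0ℓ)
open import Data.Nat using (ℕ)
open import Data.Fin using (Fin)
open import Data.Integer using (ℤ) renaming (_≤_ to _≤ℤ_)
open import Data.Product using (Σ; _×_; ∃)
open import Function.Bundles using (_⇔_)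
open import Relation.Binary.Core using (Rel)
open import Relation.Binary.Structures using (IsPartialOrder; IsEquivalence)
open import Relation.Binary.PropositionalEquality using (_≡_)

-- A finite poset: underlying set Fin n (any finite set, up to relabelling),
-- with a partial order _≤_ (w.r.t. propositional equality).
record FinPoset : Set₁ where
  field
    size      : ℕ
    _≤_       : Rel (Fin size) 0ℓ
    isPartialOrder : IsPartialOrder _≡_ _≤_

-- Set partitions of a set A, represented as equivalence relations
-- (the blocks are the equivalence classes).
record Partition (A : Set) : Set₁ where
  field
    _∼_   : Rel A 0ℓ
    isEquivalence : IsEquivalence _∼_

open Partition public

_≐_ : {A : Set} → Partition A → Partition A → Set
π ≐ σ = ∀ x y → (_∼_ π x y ⇔ _∼_ σ x y)

_⊓_ : {A : Set} → Partition A → Partition A → Partition A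
π ⊓ σ = record
  { _∼_ = λ x y → _∼_ π x y × _∼_ σ x y
  ; isEquivalence = record
    { refl  = IsEquivalence.refl (isEquivalence π) , IsEquivalence.refl (isEquivalence σ)
    ; sym   = λ (p , q) → IsEquivalence.sym (isEquivalence π) p , IsEquivalence.sym (isEquivalence σ) q
    ; trans = λ (p , q) (p' , q') → IsEquivalence.trans (isEquivalence π) p p'
                                  , IsEquivalence.trans (isEquivalence σ) q q'
    }
  }
  where open import Data.Product using (_,_)

module _ (P : FinPoset) where
  open FinPoset P

  OrderPreserving : (Fin size → ℤ) → Set
  OrderPreserving φ = ∀ {x y} → x ≤ y → φ x ≤ℤ φ y

  levelSet : {B : Set} → (Fin size → B) → Partition (Fin size)
  levelSet φ = record
    { _∼_ = λ x y → φ x ≡ φ y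
    ; isEquivalence = record
      { refl = Eq.refl ; sym = Eq.sym ; trans = Eq.trans } }
    where import Relation.Binary.PropositionalEquality as Eq

  InO : Partition (Fin size) → Set
  InO π = Σ (Fin size → ℤ) λ φ → OrderPreserving φ × (levelSet φ ≐ π)

-- Two order-preserving maps φ, ψ : P → ℤ combine lexicographically into
-- χ = N·φ + ψ, which is again order-preserving for any N ≥ 0. Once N exceeds
-- every difference ψ y − ψ x (possible because P is finite), χ x = χ y forces
-- φ x = φ y and then ψ x = ψ y, so the fibres of χ are exactly the common
-- refinement of the fibres of φ and ψ.
module Submission where

open import Defs
open import Data.Fin using (Fin)
open import Data.List using (map; allFin)
open import Data.List.Extrema.Nat using (max; v≤max⁺)
open import Data.List.Membership.Propositional.Properties using (∈-map⁺; ∈-allFin)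
open import Data.List.Membership.Propositional using (lose)
open import Data.Nat as ℕ using (ℕ; suc)
import Data.Nat.Properties as ℕ
open import Data.Integer as ℤ using (ℤ; +_; _+_; _*_; _-_; ∣_∣)
import Data.Integer.Properties as ℤ
open import Data.Integer.Tactic.RingSolver using (solve-∀)
open import Data.Product using (_×_; _,_)
open import Data.Sum using (inj₂)
open import Function using (_∘_)
open import Function.Bundles using (mk⇔; Equivalence)
open import Relation.Binary.PropositionalEquality

maxAbs : {n : ℕ} → (Fin n → ℤ) → ℕ
maxAbs {n} f = max 0 (map (∣_∣ ∘ f) (allFin n))

∣f∣≤maxAbs : {n : ℕ} (f : Fin n → ℤ) (i : Fin n) → ∣ f i ∣ ℕ.≤ maxAbs f
∣f∣≤maxAbs {n} f i =
  v≤max⁺ 0 (map (∣_∣ ∘ f) (allFin n)) (inj₂ (lose (∈-map⁺ (∣_∣ ∘ f) (∈-allFin i)) ℕ.≤-refl))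

∣f-f∣<1+2maxAbs : {n : ℕ} (f : Fin n → ℤ) (i j : Fin n) →
                  ∣ f j - f i ∣ ℕ.< suc (maxAbs f ℕ.+ maxAbs f)
∣f-f∣<1+2maxAbs f i j = ℕ.s≤s (ℕ.≤-trans (ℤ.∣i-j∣≤∣i∣+∣j∣ (f j) (f i))
                                         (ℕ.+-mono-≤ (∣f∣≤maxAbs f j) (∣f∣≤maxAbs f i)))

*+-difference : (N a b c d : ℤ) → N * a + b ≡ N * c + d → N * (a - c) ≡ d - b
*+-difference N a b c d eq = begin
  N * (a - c)                   ≡⟨ expand N a b c ⟩
  (N * a + b) - (N * c + b)     ≡⟨ cong (λ z → z - (N * c + b)) eq ⟩
  (N * c + d) - (N * c + b)     ≡⟨ contract N c d b ⟩
  d - b                         ∎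
  where
  open ≡-Reasoning
  expand : ∀ N a b c → N * (a - c) ≡ (N * a + b) - (N * c + b)
  expand = solve-∀
  contract : ∀ N c d b → (N * c + d) - (N * c + b) ≡ d - b
  contract = solve-∀

*+-injective : (N : ℕ) (a b c d : ℤ) → + N * a + b ≡ + N * c + d →
               ∣ d - b ∣ ℕ.< N → a ≡ c × b ≡ d
*+-injective N a b c d eq small = ℤ.i-j≡0⇒i≡j a c a-c≡0 , sym (ℤ.i-j≡0⇒i≡j d b d-b≡0)
  where
  difference : + N * (a - c) ≡ d - b
  difference = *+-difference (+ N) a b c d eq
  N*∣a-c∣<N*1 : N ℕ.* ∣ a - c ∣ ℕ.< N ℕ.* 1
  N*∣a-c∣<N*1 = begin-strict
    N ℕ.* ∣ a - c ∣     ≡⟨ ℤ.∣i*j∣≡∣i∣*∣j∣ (+ N) (a - c) ⟨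
    ∣ + N * (a - c) ∣   ≡⟨ cong ∣_∣ difference ⟩
    ∣ d - b ∣           <⟨ small ⟩
    N                   ≡⟨ ℕ.*-identityʳ N ⟨
    N ℕ.* 1             ∎
    where open ℕ.≤-Reasoning
  a-c≡0 : a - c ≡ + 0
  a-c≡0 = ℤ.∣i∣≡0⇒i≡0 (ℕ.n<1⇒n≡0 (ℕ.*-cancelˡ-< N ∣ a - c ∣ 1 N*∣a-c∣<N*1))
  d-b≡0 : d - b ≡ + 0
  d-b≡0 = trans (sym difference) (trans (cong (+ N *_) a-c≡0) (ℤ.*-zeroʳ (+ N)))

≐-trans : {A : Set} {π σ τ : Partition A} → π ≐ σ → σ ≐ τ → π ≐ τ
≐-trans π≐σ σ≐τ x y = mk⇔ (Equivalence.to (σ≐τ x y) ∘ Equivalence.to (π≐σ x y))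
                           (Equivalence.from (π≐σ x y) ∘ Equivalence.from (σ≐τ x y))

⊓-cong : {A : Set} {π π′ σ σ′ : Partition A} → π ≐ π′ → σ ≐ σ′ → (π ⊓ σ) ≐ (π′ ⊓ σ′)
⊓-cong π≐π′ σ≐σ′ x y = mk⇔
  (λ (p , q) → Equivalence.to (π≐π′ x y) p , Equivalence.to (σ≐σ′ x y) q)
  (λ (p , q) → Equivalence.from (π≐π′ x y) p , Equivalence.from (σ≐σ′ x y) q)

module _ (P : FinPoset) where
  open FinPoset P

  lexCombine : ℕ → (Fin size → ℤ) → (Fin size → ℤ) → Fin size → ℤ
  lexCombine N φ ψ x = + N * φ x + ψ x

  lexCombine-orderPreserving : (N : ℕ) {φ ψ : Fin size → ℤ} →
    OrderPreserving P φ → OrderPreserving P ψ → OrderPreserving P (lexCombine N φ ψ)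
  lexCombine-orderPreserving N φ-mono ψ-mono x≤y =
    ℤ.+-mono-≤ (ℤ.*-monoˡ-≤-nonNeg (+ N) (φ-mono x≤y)) (ψ-mono x≤y)

  levelSet-lexCombine : (N : ℕ) (φ ψ : Fin size → ℤ) → (∀ x y → ∣ ψ y - ψ x ∣ ℕ.< N) →
                        levelSet P (lexCombine N φ ψ) ≐ (levelSet P φ ⊓ levelSet P ψ)
  levelSet-lexCombine N φ ψ ψ-small x y = mk⇔
    (λ eq → *+-injective N (φ x) (ψ x) (φ y) (ψ y) eq (ψ-small x y))
    (λ (φx≡φy , ψx≡ψy) → cong₂ (λ u v → + N * u + v) φx≡φy ψx≡ψy)

lemma4p3 : (P : FinPoset) → (π σ : Partition (Fin (FinPoset.size P)))
    → InO P π → InO P σ → InO P (π ⊓ σ)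
lemma4p3 P π σ (φ , φ-mono , φ≐π) (ψ , ψ-mono , ψ≐σ) =
  χ , lexCombine-orderPreserving P N φ-mono ψ-mono , ≐-trans {_} {levelSet P χ} {φψ} {π ⊓ σ} χ≐φψ φψ≐πσ
  where
  -- ≐ only mentions the _∼_ fields, so the partitions cannot be inferred and are given explicitly.
  N : ℕ
  N = suc (maxAbs ψ ℕ.+ maxAbs ψ)
  χ : Fin (FinPoset.size P) → ℤ
  χ = lexCombine P N φ ψ
  φψ : Partition (Fin (FinPoset.size P))
  φψ = levelSet P φ ⊓ levelSet P ψ
  χ≐φψ : levelSet P χ ≐ φψ
  χ≐φψ = levelSet-lexCombine P N φ ψ (∣f-f∣<1+2maxAbs ψ)
  φψ≐πσ : φψ ≐ (π ⊓ σ)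
  φψ≐πσ = ⊓-cong {_} {levelSet P φ} {π} {levelSet P ψ} {σ} φ≐π ψ≐σ
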